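{- Let $f_0(1)=0$ and $f_0(n)=1$ for $n\ge2$, and let $f_m$, $c_m(n,k)$ be as in the context, with $m\ge1$ an integer. For $n>3$ and $1\le k\le\lfloor n/2\rfloor$, $c_m(n,k)$ equals the number of words of length $n-3$ over the alphabet $\{0,1,\ldots,m\}$ with exactly $k-1$ letters equal to $1$ in which all nonzero letters are isolated (no two consecutive letters are both nonzero). Moreover, for $1\le k\le\lfloor n/2\rfloor$, \[ c_m(n,k)=\sum_{j=0}^{\lfloor n/2\rfloor-k}(m-1)^{j}\binom{j+k-1}{k-1}\binom{n-k-j-1}{k+j-1} \] (with $0^0=1$), and $c_m(n,k)=0$ when $\lfloor n/2\rfloor<k\le n$.
   Context: For $m\ge1$, $f_m$ is the $m$th invert transform of $f_0$: $f_m(0)=1$ and $f_m(n)=\sum_{i=1}^{n} f_{m-1}(i)\,f_m(n-i)$ for $n\ge1$. For $m\ge1$ and $0\le k\le n$: $c_m(0,0)=1$, $c_m(n,0)=0$ for $n\ge1$, and $c_m(n,k)=\sum_{i=1}^{n-k+1} f_{m-1}(i)\,c_m(n-i,k-1)$ for $1\le k\le n$. -}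

module Defs where

open import Data.Nat using (ℕ; zero; suc; _+_; _*_; _∸_; _^_; _/_)
open import Data.Nat.Combinatorics using (_C_)
open import Data.Bool using (Bool; true; false; not; _∧_; if_then_else_)
open import Data.Fin using (Fin; toℕ)
open import Data.Nat.ListAction using (sum)
open import Data.List using (List; []; _∷_; map; upTo; zipWith; concatMap; allFin)
open import Data.Vec using (Vec; []; _∷_)
open import Data.Vec as V using ()
open import Data.List using () renaming (map to lmap)

sum1 : ℕ → (ℕ → ℕ) → ℕ
sum1 n g = sum (map (λ i → g (suc i)) (upTo n))

sum0 : ℕ → (ℕ → ℕ) → ℕ
sum0 n g = sum (map g (upTo (suc n)))

-- f_0(1) = 0, f_0(n) = 1 for n ≥ 2.  (f_0(0) is never used; set to 0.)
f0 : ℕ → ℕ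
f0 zero = 0
f0 (suc zero) = 0
f0 (suc (suc n)) = 1

-- invert transform of g: h(0) = 1, h(n) = Σ_{i=1}^{n} g(i) h(n-i).
-- invertVals g n = [h n, h (n-1), ..., h 0]
invertVals : (ℕ → ℕ) → ℕ → List ℕ
invertVals g zero = 1 ∷ []
invertVals g (suc n) =
  sum (zipWith (λ i v → g (suc i) * v) (upTo (suc n)) (invertVals g n)) ∷ invertVals g n

head0 : List ℕ → ℕ
head0 [] = 0
head0 (x ∷ _) = x

invert : (ℕ → ℕ) → ℕ → ℕ
invert g n = head0 (invertVals g n)

f : ℕ → ℕ → ℕ
f zero = f0
f (suc m) = invert (f m)

cWith : (ℕ → ℕ) → ℕ → ℕ → ℕ
cWith g zero zero = 1
cWith g (suc n) zero = 0
cWith g n (suc k) = sum1 (n ∸ k) (λ i → g i * cWith g (n ∸ i) k)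

-- c m n k = c_m(n,k)  (meaningful for m ≥ 1)
c : ℕ → ℕ → ℕ → ℕ
c m = cWith (f (m ∸ 1))

allWords : (m L : ℕ) → List (Vec (Fin (suc m)) L)
allWords m zero = [] ∷ []
allWords m (suc L) = concatMap (λ a → lmap (a ∷_) (allWords m L)) (allFin (suc m))

count : {A : Set} → (A → Bool) → List A → ℕ
count p [] = 0
count p (x ∷ xs) = (if p x then 1 else 0) + count p xs

isOne : ℕ → Bool
isOne (suc zero) = true
isOne _ = false

isNonzero : ℕ → Bool
isNonzero zero = false
isNonzero (suc _) = true

onesCount : ∀ {m L} → Vec (Fin (suc m)) L → ℕ
onesCount [] = 0
onesCount (a ∷ w) = (if isOne (toℕ a) then 1 else 0) + onesCount w

isolatedB : ∀ {m L} → Vec (Fin (suc m)) L → Bool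
isolatedB [] = true
isolatedB (a ∷ []) = true
isolatedB (a ∷ b ∷ w) = not (isNonzero (toℕ a) ∧ isNonzero (toℕ b)) ∧ isolatedB (b ∷ w)

eqℕ : ℕ → ℕ → Bool
eqℕ zero zero = true
eqℕ zero (suc _) = false
eqℕ (suc _) zero = false
eqℕ (suc a) (suc b) = eqℕ a b

numWords : (m L j : ℕ) → ℕ
numWords m L j = count (λ w → eqℕ (onesCount w) j ∧ isolatedB w) (allWords m L)

closedForm : (m n k : ℕ) → ℕ
closedForm m n k =
  sum0 (n / 2 ∸ k) (λ j → ((m ∸ 1) ^ j) * ((j + k ∸ 1) C (k ∸ 1)) * ((n ∸ k ∸ j ∸ 1) C (k + j ∸ 1)))

-- With a = m − 1, the sequence f_a has generating function x²/(1 − x − a x²), i.e. it satisfies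
-- g(n + 2) = g(n + 1) + a g(n) from g(1) = 0, g(2) = 1.  Convolving with it turns the defining sum of
-- c_m into the three-term recurrence c(n + 2, k + 1) = c(n + 1, k + 1) + a c(n, k + 1) + c(n, k), with
-- c(n, k) = 0 for n < 2k.  Counting words by their first letter (0, 1, or one of the a letters ≥ 2)
-- gives the same recurrence.  Expanding c(n, k + 1) in powers of a, with binomial coefficients from
-- Pascal's rule, reduces the closed form to the case a = 0, where c(n, q + 1) = C(n − q − 2, q).
module Submission where

open import Defs
open import Data.Nat using (ℕ; zero; suc; _+_; _*_; _^_; _∸_; _/_; _%_; _≤_; _<_; z≤n; s≤s)
open import Data.Nat.Properties
open import Data.Nat.DivMod using (m≡m%n+[m/n]*n; m%n<n; m/n*n≤m)
open import Data.Nat.Combinatorics using (_C_; nCn≡1; k>n⇒nCk≡0; nCk+nC[k+1]≡[n+1]C[k+1])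
open import Data.Nat.ListAction using (sum)
open import Data.Nat.Solver using (module +-*-Solver)
open import Data.Bool using (Bool; true; false; not; _∧_; if_then_else_)
open import Data.Bool.Properties using (∧-zeroʳ)
open import Data.Fin using (Fin; toℕ) renaming (zero to fz; suc to fs)
open import Data.Vec using (Vec; []; _∷_)
open import Data.List using (List; []; _∷_; map; upTo; applyUpTo; _++_; concatMap; allFin; zipWith; tabulate)
open import Data.List.Properties using (map-cong)
open import Data.Product using (_×_; _,_)
open import Relation.Binary.PropositionalEquality
  using (_≡_; refl; sym; trans; cong; cong₂; subst; module ≡-Reasoning)
open +-*-Solver using (solve; _:+_; _:*_; _:=_; con)

∑ : ℕ → (ℕ → ℕ) → ℕ
∑ zero    F = 0
∑ (suc n) F = F 0 + ∑ n (λ i → F (suc i))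

∑-cong< : ∀ n {F G : ℕ → ℕ} → (∀ i → i < n → F i ≡ G i) → ∑ n F ≡ ∑ n G
∑-cong< zero    eq = refl
∑-cong< (suc n) eq = cong₂ _+_ (eq 0 (s≤s z≤n)) (∑-cong< n (λ i i<n → eq (suc i) (s≤s i<n)))

∑-cong : ∀ n {F G : ℕ → ℕ} → (∀ i → F i ≡ G i) → ∑ n F ≡ ∑ n G
∑-cong n eq = ∑-cong< n (λ i _ → eq i)

∑-+ : ∀ n (F G : ℕ → ℕ) → ∑ n (λ i → F i + G i) ≡ ∑ n F + ∑ n G
∑-+ zero    F G = refl
∑-+ (suc n) F G = begin
    F 0 + G 0 + ∑ n (λ i → F (suc i) + G (suc i))
  ≡⟨ cong (F 0 + G 0 +_) (∑-+ n (λ i → F (suc i)) (λ i → G (suc i))) ⟩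
    F 0 + G 0 + (X + Y)
  ≡⟨ solve 4 (λ a b x y → a :+ b :+ (x :+ y) := a :+ x :+ (b :+ y)) refl (F 0) (G 0) X Y ⟩
    F 0 + X + (G 0 + Y) ∎
  where open ≡-Reasoning
        X = ∑ n (λ i → F (suc i))
        Y = ∑ n (λ i → G (suc i))

∑-*ˡ : ∀ n a (F : ℕ → ℕ) → ∑ n (λ i → a * F i) ≡ a * ∑ n F
∑-*ˡ zero    a F = sym (*-zeroʳ a)
∑-*ˡ (suc n) a F = trans (cong (a * F 0 +_) (∑-*ˡ n a (λ i → F (suc i))))
                         (sym (*-distribˡ-+ a (F 0) _))

∑-zero : ∀ n (F : ℕ → ℕ) → (∀ i → F i ≡ 0) → ∑ n F ≡ 0
∑-zero zero    F z = refl
∑-zero (suc n) F z = cong₂ _+_ (z 0) (∑-zero n _ (λ i → z (suc i)))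

∑-truncate : ∀ p n (F : ℕ → ℕ) → p ≤ n → (∀ i → p ≤ i → F i ≡ 0) → ∑ n F ≡ ∑ p F
∑-truncate zero    n       F _         z = ∑-zero n F (λ i → z i z≤n)
∑-truncate (suc p) (suc n) F (s≤s p≤n) z =
  cong (F 0 +_) (∑-truncate p n (λ i → F (suc i)) p≤n (λ i p≤i → z (suc i) (s≤s p≤i)))

sum-applyUpTo : ∀ n F → sum (applyUpTo F n) ≡ ∑ n F
sum-applyUpTo zero    F = refl
sum-applyUpTo (suc n) F = cong (F 0 +_) (sum-applyUpTo n (λ i → F (suc i)))

map-applyUpTo : ∀ {A B : Set} (g : A → B) n (F : ℕ → A) →
  map g (applyUpTo F n) ≡ applyUpTo (λ i → g (F i)) n
map-applyUpTo g zero    F = refl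
map-applyUpTo g (suc n) F = cong (g (F 0) ∷_) (map-applyUpTo g n (λ i → F (suc i)))

zipWith-applyUpTo : ∀ {A B C : Set} (h : A → B → C) n (F : ℕ → A) (G : ℕ → B) →
  zipWith h (applyUpTo F n) (applyUpTo G n) ≡ applyUpTo (λ i → h (F i) (G i)) n
zipWith-applyUpTo h zero    F G = refl
zipWith-applyUpTo h (suc n) F G =
  cong (h (F 0) (G 0) ∷_) (zipWith-applyUpTo h n (λ i → F (suc i)) (λ i → G (suc i)))

sum1≡∑ : ∀ n g → sum1 n g ≡ ∑ n (λ i → g (suc i))
sum1≡∑ n g = trans (cong sum (map-applyUpTo (λ i → g (suc i)) n (λ i → i)))
                   (sum-applyUpTo n (λ i → g (suc i)))

sum0≡∑ : ∀ n g → sum0 n g ≡ ∑ (suc n) g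
sum0≡∑ n g = trans (cong sum (map-applyUpTo g (suc n) (λ i → i)))
                   (sum-applyUpTo (suc n) g)

conv : (ℕ → ℕ) → (ℕ → ℕ) → ℕ → ℕ
conv g u n = ∑ n (λ i → g (suc i) * u (n ∸ suc i))

record FibLike (a : ℕ) (g : ℕ → ℕ) : Set where
  constructor fibLike
  field
    at-1       : g 1 ≡ 0
    at-2       : g 2 ≡ 1
    recurrence : ∀ i → g (3 + i) ≡ g (2 + i) + a * g (1 + i)

module _ {a : ℕ} {g : ℕ → ℕ} (fib : FibLike a g) (u : ℕ → ℕ) where

  open FibLike fib

  conv-fibLike-1 : conv g u 1 ≡ 0
  conv-fibLike-1 rewrite at-1 = refl

  conv-fibLike-rec : ∀ n → conv g u (2 + n) ≡ u n + conv g u (1 + n) + a * conv g u n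
  conv-fibLike-rec n = begin
      g 1 * u (suc n) + (g 2 * u n + ∑ n (λ i → g (3 + i) * u (n ∸ suc i)))
    ≡⟨ cong₂ (λ x y → x * u (suc n) + (y * u n + ∑ n (λ i → g (3 + i) * u (n ∸ suc i)))) at-1 at-2 ⟩
      1 * u n + ∑ n (λ i → g (3 + i) * u (n ∸ suc i))
    ≡⟨ cong₂ _+_ (*-identityˡ (u n)) (∑-cong n split) ⟩
      u n + ∑ n (λ i → g (2 + i) * u (n ∸ suc i) + a * (g (1 + i) * u (n ∸ suc i)))
    ≡⟨ cong (u n +_) (∑-+ n _ _) ⟩
      u n + (X + ∑ n (λ i → a * (g (1 + i) * u (n ∸ suc i))))
    ≡⟨ cong (λ z → u n + (X + z)) (∑-*ˡ n a _) ⟩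
      u n + (X + a * conv g u n)
    ≡⟨ sym (+-assoc (u n) X _) ⟩
      u n + X + a * conv g u n
    ≡⟨ cong (λ y → u n + (y * u n + X) + a * conv g u n) (sym at-1) ⟩
      u n + conv g u (suc n) + a * conv g u n ∎
    where
      open ≡-Reasoning
      X = ∑ n (λ i → g (2 + i) * u (n ∸ suc i))
      split : ∀ i → g (3 + i) * u (n ∸ suc i) ≡ g (2 + i) * u (n ∸ suc i) + a * (g (1 + i) * u (n ∸ suc i))
      split i = begin
          g (3 + i) * u (n ∸ suc i)
        ≡⟨ cong (_* u (n ∸ suc i)) (recurrence i) ⟩
          (g (2 + i) + a * g (1 + i)) * u (n ∸ suc i)
        ≡⟨ *-distribʳ-+ (u (n ∸ suc i)) (g (2 + i)) (a * g (1 + i)) ⟩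
          g (2 + i) * u (n ∸ suc i) + a * g (1 + i) * u (n ∸ suc i)
        ≡⟨ cong (g (2 + i) * u (n ∸ suc i) +_) (*-assoc a (g (1 + i)) (u (n ∸ suc i))) ⟩
          g (2 + i) * u (n ∸ suc i) + a * (g (1 + i) * u (n ∸ suc i)) ∎

invertVals≡applyUpTo : ∀ h n → invertVals h n ≡ applyUpTo (λ i → invert h (n ∸ i)) (suc n)
invertVals≡applyUpTo h zero    = refl
invertVals≡applyUpTo h (suc n) = cong (invert h (suc n) ∷_) (invertVals≡applyUpTo h n)

invert-suc : ∀ h n → invert h (suc n) ≡ conv h (invert h) (suc n)
invert-suc h n = begin
    sum (zipWith (λ i v → h (suc i) * v) (upTo (suc n)) (invertVals h n))
  ≡⟨ cong (λ l → sum (zipWith (λ i v → h (suc i) * v) (upTo (suc n)) l)) (invertVals≡applyUpTo h n) ⟩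
    sum (zipWith (λ i v → h (suc i) * v) (upTo (suc n)) (applyUpTo (λ i → invert h (n ∸ i)) (suc n)))
  ≡⟨ cong sum (zipWith-applyUpTo (λ i v → h (suc i) * v) (suc n) (λ i → i) (λ i → invert h (n ∸ i))) ⟩
    sum (applyUpTo (λ i → h (suc i) * invert h (n ∸ i)) (suc n))
  ≡⟨ sum-applyUpTo (suc n) (λ i → h (suc i) * invert h (n ∸ i)) ⟩
    conv h (invert h) (suc n) ∎
  where open ≡-Reasoning

invert-fibLike : ∀ {a g} → FibLike a g → FibLike (suc a) (invert g)
invert-fibLike {a} {g} fib = fibLike h1≡0 h2≡1 h-rec
  where
    h = invert g
    h1≡0 : h 1 ≡ 0
    h1≡0 = trans (invert-suc g 0) (conv-fibLike-1 fib h)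
    h2≡1 : h 2 ≡ 1
    h2≡1 = trans (invert-suc g 1) (trans (conv-fibLike-rec fib h 0)
             (cong₂ (λ x y → 1 + x + y) (conv-fibLike-1 fib h) (*-zeroʳ a)))
    h-rec : ∀ i → h (3 + i) ≡ h (2 + i) + suc a * h (1 + i)
    h-rec i = begin
        h (3 + i)
      ≡⟨ invert-suc g (2 + i) ⟩
        conv g h (3 + i)
      ≡⟨ conv-fibLike-rec fib h (1 + i) ⟩
        h (1 + i) + conv g h (2 + i) + a * conv g h (1 + i)
      ≡⟨ cong₂ (λ x y → h (1 + i) + x + a * y) (sym (invert-suc g (1 + i))) (sym (invert-suc g i)) ⟩
        h (1 + i) + h (2 + i) + a * h (1 + i)
      ≡⟨ solve 3 (λ x y z → x :+ y :+ z := y :+ (x :+ z)) refl (h (1 + i)) (h (2 + i)) (a * h (1 + i)) ⟩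
        h (2 + i) + suc a * h (1 + i) ∎
      where open ≡-Reasoning

f-fibLike : ∀ m → FibLike m (f m)
f-fibLike zero    = fibLike refl refl (λ i → refl)
f-fibLike (suc m) = invert-fibLike (f-fibLike m)

cRec : ℕ → ℕ → ℕ → ℕ
cRec a zero          zero    = 1
cRec a (suc n)       zero    = 0
cRec a zero          (suc k) = 0
cRec a (suc zero)    (suc k) = 0
cRec a (suc (suc n)) (suc k) = cRec a (suc n) (suc k) + a * cRec a n (suc k) + cRec a n k

cWith-suc : ∀ g n k → cWith g n (suc k) ≡ ∑ (n ∸ k) (λ i → g (suc i) * cWith g (n ∸ suc i) k)
cWith-suc g zero    k = sum1≡∑ (zero ∸ k) (λ i → g i * cWith g (zero ∸ i) k)
cWith-suc g (suc n) k = sum1≡∑ (suc n ∸ k) (λ i → g i * cWith g (suc n ∸ i) k)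

cWith-<⇒0 : ∀ g n k → n < k → cWith g n k ≡ 0
cWith-<⇒0 g n (suc k) (s≤s n≤k) =
  trans (cWith-suc g n k) (cong (λ z → ∑ z (λ i → g (suc i) * cWith g (n ∸ suc i) k)) (m≤n⇒m∸n≡0 n≤k))

-- Extending the range of summation from n − k to n only adds terms with cWith g (n − 1 − i) k = 0.
cWith-conv : ∀ g n k → cWith g n (suc k) ≡ conv g (λ x → cWith g x k) n
cWith-conv g n zero    = cWith-suc g n zero
cWith-conv g n (suc k) =
  trans (cWith-suc g n (suc k))
        (sym (∑-truncate (n ∸ suc k) n _ (m∸n≤m n (suc k)) vanish))
  where
    vanish : ∀ i → n ∸ suc k ≤ i → g (suc i) * cWith g (n ∸ suc i) (suc k) ≡ 0
    vanish i n∸k≤i =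
      trans (cong (g (suc i) *_) (cWith-<⇒0 g (n ∸ suc i) (suc k) (s≤s bound))) (*-zeroʳ (g (suc i)))
      where
        bound : n ∸ suc i ≤ k
        bound = m≤n+o⇒m∸n≤o n (suc i) (≤-trans (m≤n+m∸n n (suc k))
                  (≤-trans (+-monoʳ-≤ (suc k) n∸k≤i) (≤-reflexive (cong suc (+-comm k i)))))

cWith-fibLike : ∀ {a g} → FibLike a g → ∀ n k → cWith g n k ≡ cRec a n k
cWith-fibLike fib zero          zero    = refl
cWith-fibLike fib (suc n)       zero    = refl
cWith-fibLike {g = g} fib zero  (suc k) = cWith-conv g 0 k
cWith-fibLike {g = g} fib (suc zero) (suc k) =
  trans (cWith-conv g 1 k) (conv-fibLike-1 fib (λ x → cWith g x k))
cWith-fibLike {a} {g} fib (suc (suc n)) (suc k) = begin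
    cWith g (2 + n) (suc k)
  ≡⟨ cWith-conv g (2 + n) k ⟩
    conv g u (2 + n)
  ≡⟨ conv-fibLike-rec fib u n ⟩
    u n + conv g u (1 + n) + a * conv g u n
  ≡⟨ cong₂ (λ x y → u n + x + a * y) (sym (cWith-conv g (1 + n) k)) (sym (cWith-conv g n k)) ⟩
    u n + cWith g (1 + n) (suc k) + a * cWith g n (suc k)
  ≡⟨ cong₂ _+_ (cong₂ _+_ (cWith-fibLike fib n k) (cWith-fibLike fib (suc n) (suc k)))
               (cong (a *_) (cWith-fibLike fib n (suc k))) ⟩
    cRec a n k + cRec a (1 + n) (suc k) + a * cRec a n (suc k)
  ≡⟨ solve 3 (λ x y z → x :+ y :+ z := y :+ z :+ x) refl
       (cRec a n k) (cRec a (1 + n) (suc k)) (a * cRec a n (suc k)) ⟩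
    cRec a (2 + n) (suc k) ∎
  where open ≡-Reasoning
        u = λ x → cWith g x k

cRec-<⇒0 : ∀ a n k → n < k + k → cRec a n k ≡ 0
cRec-<⇒0 a n             zero    ()
cRec-<⇒0 a zero          (suc k) _ = refl
cRec-<⇒0 a (suc zero)    (suc k) _ = refl
cRec-<⇒0 a (suc (suc n)) (suc k) (s≤s n+1<2k+1) = begin
    cRec a (suc n) (suc k) + a * cRec a n (suc k) + cRec a n k
  ≡⟨ cong₂ (λ x y → x + a * y + cRec a n k)
       (cRec-<⇒0 a (suc n) (suc k) (m≤n⇒m≤1+n n+1<2k+1))
       (cRec-<⇒0 a n (suc k) (m≤n⇒m≤1+n (≤-trans (n≤1+n _) n+1<2k+1))) ⟩
    a * 0 + cRec a n k
  ≡⟨ cong (_+ cRec a n k) (*-zeroʳ a) ⟩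
    cRec a n k
  ≡⟨ cRec-<⇒0 a n k (≤-pred (≤-trans n+1<2k+1 (≤-reflexive (+-suc k k)))) ⟩
    0 ∎
  where open ≡-Reasoning

/2<⇒<+ : ∀ n k → n / 2 < k → n < k + k
/2<⇒<+ n k n/2<k = begin-strict
    n
  ≡⟨ m≡m%n+[m/n]*n n 2 ⟩
    n % 2 + n / 2 * 2
  <⟨ +-monoˡ-< (n / 2 * 2) (m%n<n n 2) ⟩
    suc (n / 2) * 2
  ≤⟨ *-monoˡ-≤ 2 n/2<k ⟩
    k * 2
  ≡⟨ *-comm k 2 ⟩
    k + (k + 0)
  ≡⟨ cong (k +_) (+-identityʳ k) ⟩
    k + k ∎
  where open ≤-Reasoning

count-++ : ∀ {A : Set} (p : A → Bool) xs ys → count p (xs ++ ys) ≡ count p xs + count p ys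
count-++ p []       ys = refl
count-++ p (x ∷ xs) ys = trans (cong ((if p x then 1 else 0) +_) (count-++ p xs ys))
                               (sym (+-assoc (if p x then 1 else 0) _ _))

count-concatMap : ∀ {A B : Set} (p : A → Bool) (h : B → List A) bs →
  count p (concatMap h bs) ≡ sum (map (λ b → count p (h b)) bs)
count-concatMap p h []       = refl
count-concatMap p h (b ∷ bs) = trans (count-++ p (h b) (concatMap h bs))
                                     (cong (count p (h b) +_) (count-concatMap p h bs))

count-map : ∀ {A B : Set} (p : A → Bool) (h : B → A) xs → count p (map h xs) ≡ count (λ x → p (h x)) xs
count-map p h []       = refl
count-map p h (x ∷ xs) = cong ((if p (h x) then 1 else 0) +_) (count-map p h xs)

count-cong : ∀ {A : Set} {p q : A → Bool} xs → (∀ x → p x ≡ q x) → count p xs ≡ count q xs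
count-cong []       eq = refl
count-cong (x ∷ xs) eq = cong₂ (λ b n → (if b then 1 else 0) + n) (eq x) (count-cong xs eq)

count-false : ∀ {A : Set} (p : A → Bool) xs → (∀ x → p x ≡ false) → count p xs ≡ 0
count-false p []       eq = refl
count-false p (x ∷ xs) eq rewrite eq x = count-false p xs eq

sum-map-tabulate-const : ∀ {A : Set} n (h : Fin n → A) (T : A → ℕ) v → (∀ x → T (h x) ≡ v) →
  sum (map T (tabulate h)) ≡ n * v
sum-map-tabulate-const zero    h T v eq = refl
sum-map-tabulate-const (suc n) h T v eq =
  cong₂ _+_ (eq fz) (sum-map-tabulate-const n (λ x → h (fs x)) T v (λ x → eq (fs x)))

module _ {m : ℕ} where

  Word : ℕ → Set
  Word = Vec (Fin (suc m))

  startsWithZero : ∀ {L} → Word L → Bool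
  startsWithZero []      = true
  startsWithZero (a ∷ _) = not (isNonzero (toℕ a))

  -- b records whether the word is preceded by a nonzero letter.
  isolatedAfter : ∀ {L} → Bool → Word L → Bool
  isolatedAfter b w = (if b then startsWithZero w else true) ∧ isolatedB w

  isolated-∷ : ∀ {L} (a : Fin (suc m)) (w : Word L) →
    isolatedB (a ∷ w) ≡ isolatedAfter (isNonzero (toℕ a)) w
  isolated-∷ a []      with isNonzero (toℕ a)
  ... | true  = refl
  ... | false = refl
  isolated-∷ a (b ∷ w) with isNonzero (toℕ a)
  ... | true  = refl
  ... | false = refl

wordsAfter : (m L j : ℕ) → Bool → ℕ
wordsAfter m L j b = count (λ w → eqℕ (onesCount w) j ∧ isolatedAfter b w) (allWords m L)

wordsStartingWith : (m L j : ℕ) → Bool → Fin (suc m) → ℕ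
wordsStartingWith m L j b a =
  count (λ w → eqℕ (onesCount (a ∷ w)) j ∧ isolatedAfter b (a ∷ w)) (allWords m L)

wordsAfter-suc : ∀ m L j b → wordsAfter m (suc L) j b ≡ sum (map (wordsStartingWith m L j b) (allFin (suc m)))
wordsAfter-suc m L j b =
  trans (count-concatMap p (λ a → map (a ∷_) (allWords m L)) (allFin (suc m)))
        (cong sum (map-cong (λ a → count-map p (a ∷_) (allWords m L)) (allFin (suc m))))
  where p = λ (w : Word (suc L)) → eqℕ (onesCount w) j ∧ isolatedAfter b w

wordsStartingWith-0 : ∀ m L j b → wordsStartingWith m L j b fz ≡ wordsAfter m L j false
wordsStartingWith-0 m L j true  =
  count-cong (allWords m L) (λ w → cong (eqℕ (onesCount w) j ∧_) (isolated-∷ fz w))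
wordsStartingWith-0 m L j false =
  count-cong (allWords m L) (λ w → cong (eqℕ (onesCount w) j ∧_) (isolated-∷ fz w))

wordsStartingWith-nonzero-after-nonzero : ∀ m L j (a : Fin m) → wordsStartingWith m L j true (fs a) ≡ 0
wordsStartingWith-nonzero-after-nonzero m L j a = count-false _ (allWords m L) (λ w → ∧-zeroʳ _)

wordsStartingWith-1-ones-0 : ∀ m L → wordsStartingWith (suc m) L 0 false (fs fz) ≡ 0
wordsStartingWith-1-ones-0 m L = count-false _ (allWords (suc m) L) (λ w → refl)

wordsStartingWith-1 : ∀ m L j → wordsStartingWith (suc m) L (suc j) false (fs fz) ≡ wordsAfter (suc m) L j true
wordsStartingWith-1 m L j =
  count-cong (allWords (suc m) L) (λ w → cong (eqℕ (onesCount w) j ∧_) (isolated-∷ (fs fz) w))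

wordsStartingWith-≥2 : ∀ m L j (a : Fin m) →
  wordsStartingWith (suc m) L j false (fs (fs a)) ≡ wordsAfter (suc m) L j true
wordsStartingWith-≥2 m L j a =
  count-cong (allWords (suc m) L) (λ w → cong (eqℕ (onesCount w) j ∧_) (isolated-∷ (fs (fs a)) w))

wordsAfter-true-suc : ∀ m L j → wordsAfter (suc m) (suc L) j true ≡ wordsAfter (suc m) L j false
wordsAfter-true-suc m L j = begin
    wordsAfter (suc m) (suc L) j true
  ≡⟨ wordsAfter-suc (suc m) L j true ⟩
    S fz + (S (fs fz) + sum (map S (tabulate (λ x → fs (fs x)))))
  ≡⟨ cong₂ _+_ (wordsStartingWith-0 (suc m) L j true)
       (cong₂ _+_ (wordsStartingWith-nonzero-after-nonzero (suc m) L j fz)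
                  (sum-map-tabulate-const m (λ x → fs (fs x)) S 0
                     (λ x → wordsStartingWith-nonzero-after-nonzero (suc m) L j (fs x)))) ⟩
    wordsAfter (suc m) L j false + m * 0
  ≡⟨ trans (cong (wordsAfter (suc m) L j false +_) (*-zeroʳ m)) (+-identityʳ _) ⟩
    wordsAfter (suc m) L j false ∎
  where open ≡-Reasoning
        S = wordsStartingWith (suc m) L j true

wordsAfter-false-suc-0 : ∀ m L →
  wordsAfter (suc m) (suc L) 0 false ≡ wordsAfter (suc m) L 0 false + m * wordsAfter (suc m) L 0 true
wordsAfter-false-suc-0 m L = begin
    wordsAfter (suc m) (suc L) 0 false
  ≡⟨ wordsAfter-suc (suc m) L 0 false ⟩
    S fz + (S (fs fz) + sum (map S (tabulate (λ x → fs (fs x)))))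
  ≡⟨ cong₂ _+_ (wordsStartingWith-0 (suc m) L 0 false)
       (cong₂ _+_ (wordsStartingWith-1-ones-0 m L)
                  (sum-map-tabulate-const m (λ x → fs (fs x)) S _ (wordsStartingWith-≥2 m L 0))) ⟩
    wordsAfter (suc m) L 0 false + m * wordsAfter (suc m) L 0 true ∎
  where open ≡-Reasoning
        S = wordsStartingWith (suc m) L 0 false

wordsAfter-false-suc-suc : ∀ m L j → wordsAfter (suc m) (suc L) (suc j) false ≡
  wordsAfter (suc m) L (suc j) false + m * wordsAfter (suc m) L (suc j) true + wordsAfter (suc m) L j true
wordsAfter-false-suc-suc m L j = begin
    wordsAfter (suc m) (suc L) (suc j) false
  ≡⟨ wordsAfter-suc (suc m) L (suc j) false ⟩
    S fz + (S (fs fz) + sum (map S (tabulate (λ x → fs (fs x)))))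
  ≡⟨ cong₂ _+_ (wordsStartingWith-0 (suc m) L (suc j) false)
       (cong₂ _+_ (wordsStartingWith-1 m L j)
                  (sum-map-tabulate-const m (λ x → fs (fs x)) S _ (wordsStartingWith-≥2 m L (suc j)))) ⟩
    X + (Z + m * Y)
  ≡⟨ solve 3 (λ x y z → x :+ (z :+ y) := x :+ y :+ z) refl X (m * Y) Z ⟩
    X + m * Y + Z ∎
  where open ≡-Reasoning
        S = wordsStartingWith (suc m) L (suc j) false
        X = wordsAfter (suc m) L (suc j) false
        Y = wordsAfter (suc m) L (suc j) true
        Z = wordsAfter (suc m) L j true

cRec-wordsAfterNonzero : ∀ m L j → cRec m (2 + L) (suc j) ≡ wordsAfter (suc m) L j true
cRec-numWords : ∀ m L j → cRec m (3 + L) (suc j) ≡ numWords (suc m) L j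

cRec-wordsAfterNonzero m zero    zero    = cong (_+ 1) (*-zeroʳ m)
cRec-wordsAfterNonzero m zero    (suc j) = cong (_+ 0) (*-zeroʳ m)
cRec-wordsAfterNonzero m (suc L) j       = trans (cRec-numWords m L j) (sym (wordsAfter-true-suc m L j))

cRec-numWords m zero    zero    = cong₂ (λ x y → x + y + 0) (cRec-wordsAfterNonzero m zero zero) (*-zeroʳ m)
cRec-numWords m zero    (suc j) = cong₂ (λ x y → x + y + 0) (cRec-wordsAfterNonzero m zero (suc j)) (*-zeroʳ m)
cRec-numWords m (suc L) zero    =
  trans (trans (cong₂ (λ x y → x + m * y + 0) (cRec-numWords m L zero) (cRec-wordsAfterNonzero m L zero))
               (+-identityʳ _))
        (sym (wordsAfter-false-suc-0 m L))
cRec-numWords m (suc L) (suc j) =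
  trans (cong₂ _+_ (cong₂ (λ x y → x + m * y) (cRec-numWords m L (suc j)) (cRec-wordsAfterNonzero m L (suc j)))
                   (cRec-wordsAfterNonzero m L j))
        (sym (wordsAfter-false-suc-suc m L j))

cRec0-1 : ∀ t → cRec 0 (2 + t) 1 ≡ 1
cRec0-1 zero    = refl
cRec0-1 (suc t) rewrite cRec0-1 t = refl

cRec0-binomial : ∀ q t → cRec 0 (2 + (q + q + t)) (suc q) ≡ (q + t) C q
cRec0-binomial zero    t = cRec0-1 t
cRec0-binomial (suc q) zero = begin
    cRec 0 (2 + (q + suc q + 0)) (2 + q) + 0 + cRec 0 (1 + (q + suc q + 0)) (suc q)
  ≡⟨ cong₂ (λ x y → x + 0 + y)
       (cRec-<⇒0 0 _ (2 + q) (≤-reflexive too-short))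
       (cong (λ z → cRec 0 (suc z) (suc q)) (cong (_+ 0) (+-suc q q))) ⟩
    cRec 0 (2 + (q + q + 0)) (suc q)
  ≡⟨ cRec0-binomial q 0 ⟩
    (q + 0) C q
  ≡⟨ cong (_C q) (+-identityʳ q) ⟩
    q C q
  ≡⟨ trans (nCn≡1 q) (sym (nCn≡1 (suc q))) ⟩
    suc q C suc q
  ≡⟨ cong (_C suc q) (sym (+-identityʳ (suc q))) ⟩
    (suc q + 0) C suc q ∎
  where open ≡-Reasoning
        too-short : 3 + (q + suc q + 0) ≡ (2 + q) + (2 + q)
        too-short = solve 1 (λ q → con 3 :+ (q :+ (con 1 :+ q) :+ con 0) := (con 2 :+ q) :+ (con 2 :+ q)) refl q
cRec0-binomial (suc q) (suc t) = begin
    cRec 0 (2 + (q + suc q + suc t)) (2 + q) + 0 + cRec 0 (1 + (q + suc q + suc t)) (suc q)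
  ≡⟨ cong₂ (λ x y → x + 0 + y)
       (cong (λ z → cRec 0 (2 + z) (2 + q)) (+-suc (q + suc q) t))
       (cong (λ z → cRec 0 (suc z) (suc q)) (cong (_+ suc t) (+-suc q q))) ⟩
    cRec 0 (2 + (suc q + suc q + t)) (2 + q) + 0 + cRec 0 (2 + (q + q + suc t)) (suc q)
  ≡⟨ cong₂ (λ x y → x + 0 + y) (cRec0-binomial (suc q) t) (cRec0-binomial q (suc t)) ⟩
    (suc q + t) C suc q + 0 + (q + suc t) C q
  ≡⟨ cong (λ z → z C suc q + 0 + (q + suc t) C q) (sym (+-suc q t)) ⟩
    A + 0 + B
  ≡⟨ trans (cong (_+ B) (+-identityʳ A)) (+-comm A B) ⟩
    B + A
  ≡⟨ nCk+nC[k+1]≡[n+1]C[k+1] (q + suc t) q ⟩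
    suc (q + suc t) C suc q ∎
  where open ≡-Reasoning
        A = (q + suc t) C suc q
        B = (q + suc t) C q

cRec0≡C : ∀ q n → suc q + suc q ≤ n → cRec 0 n (suc q) ≡ (n ∸ suc q ∸ 1) C q
cRec0≡C q n 2q+2≤n =
  subst (λ n → cRec 0 n (suc q) ≡ (n ∸ suc q ∸ 1) C q) (m+[n∸m]≡n 2q+2≤n)
        (shifted (n ∸ (suc q + suc q)))
  where
    shifted : ∀ t → cRec 0 (suc q + suc q + t) (suc q) ≡ (suc q + suc q + t ∸ suc q ∸ 1) C q
    shifted t = begin
        cRec 0 (suc (q + suc q + t)) (suc q)
      ≡⟨ cong (λ z → cRec 0 (suc (z + t)) (suc q)) (+-suc q q) ⟩
        cRec 0 (2 + (q + q + t)) (suc q)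
      ≡⟨ cRec0-binomial q t ⟩
        (q + t) C q
      ≡⟨ cong (λ z → (z ∸ 1) C q) (sym (m+n∸m≡n (suc q) (suc q + t))) ⟩
        (suc q + (suc q + t) ∸ suc q ∸ 1) C q
      ≡⟨ cong (λ z → (z ∸ suc q ∸ 1) C q) (sym (+-assoc (suc q) (suc q) t)) ⟩
        (suc q + suc q + t ∸ suc q ∸ 1) C q ∎
      where open ≡-Reasoning

-- cRec a n (k + 1) as a polynomial in a with coefficients from cRec 0; any bound N ≥ n is exact.
expansion : (a n k N : ℕ) → ℕ
expansion a n k N = ∑ N (λ j → a ^ j * ((k + j) C k) * cRec 0 n (suc (k + j)))

expansion↓ : (a n k N : ℕ) → ℕ
expansion↓ a n k N = ∑ N (λ j → a ^ j * ((k + j) C k) * cRec 0 n (k + j))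

cRec-0 : ∀ a b n → cRec a n 0 ≡ cRec b n 0
cRec-0 a b zero    = refl
cRec-0 a b (suc n) = refl

-- Pascal's rule splits expansion↓ at k + 1 into the expansions at k and (shifted by one power of a) at k + 1.
expansion↓-suc : ∀ a n N → (∀ k M → n ≤ M → cRec a n (suc k) ≡ expansion a n k M) → n ≤ N →
  ∀ k → expansion↓ a n k (suc N) ≡ a * cRec a n (suc k) + cRec a n k
expansion↓-suc a n N expand n≤N zero = begin
    1 * 1 * cRec 0 n 0 + ∑ N (λ j → a ^ suc j * 1 * cRec 0 n (suc j))
  ≡⟨ cong₂ _+_ (trans (*-identityˡ _) (cRec-0 0 a n)) (∑-cong N shift) ⟩
    cRec a n 0 + ∑ N (λ j → a * (a ^ j * 1 * cRec 0 n (suc j)))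
  ≡⟨ cong (cRec a n 0 +_) (∑-*ˡ N a _) ⟩
    cRec a n 0 + a * expansion a n 0 N
  ≡⟨ cong (λ z → cRec a n 0 + a * z) (sym (expand 0 N n≤N)) ⟩
    cRec a n 0 + a * cRec a n 1
  ≡⟨ +-comm (cRec a n 0) _ ⟩
    a * cRec a n 1 + cRec a n 0 ∎
  where
    open ≡-Reasoning
    shift : ∀ j → a ^ suc j * 1 * cRec 0 n (suc j) ≡ a * (a ^ j * 1 * cRec 0 n (suc j))
    shift j = solve 3 (λ a p d → a :* p :* con 1 :* d := a :* (p :* con 1 :* d)) refl a (a ^ j) (cRec 0 n (suc j))
expansion↓-suc a n N expand n≤N (suc k) = begin
    expansion↓ a n (suc k) (suc N)
  ≡⟨ ∑-cong (suc N) pascal ⟩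
    ∑ (suc N) (λ j → T j + U j)
  ≡⟨ ∑-+ (suc N) T U ⟩
    expansion a n k (suc N) + (U 0 + ∑ N (λ j → U (suc j)))
  ≡⟨ cong₂ (λ x y → x + (y + ∑ N (λ j → U (suc j))))
       (sym (expand k (suc N) (m≤n⇒m≤1+n n≤N)))
       (cong (λ z → 1 * z * cRec 0 n (suc (k + 0))) (k>n⇒nCk≡0 (s≤s (≤-reflexive (+-identityʳ k))))) ⟩
    cRec a n (suc k) + ∑ N (λ j → U (suc j))
  ≡⟨ cong (cRec a n (suc k) +_) (trans (∑-cong N shift) (∑-*ˡ N a _)) ⟩
    cRec a n (suc k) + a * expansion a n (suc k) N
  ≡⟨ cong (λ z → cRec a n (suc k) + a * z) (sym (expand (suc k) N n≤N)) ⟩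
    cRec a n (suc k) + a * cRec a n (2 + k)
  ≡⟨ +-comm (cRec a n (suc k)) _ ⟩
    a * cRec a n (2 + k) + cRec a n (suc k) ∎
  where
    open ≡-Reasoning
    T U : ℕ → ℕ
    T j = a ^ j * ((k + j) C k) * cRec 0 n (suc (k + j))
    U j = a ^ j * ((k + j) C suc k) * cRec 0 n (suc (k + j))
    pascal : ∀ j → a ^ j * ((suc k + j) C suc k) * cRec 0 n (suc k + j) ≡ T j + U j
    pascal j = trans (cong (λ z → a ^ j * z * cRec 0 n (suc (k + j))) (sym (nCk+nC[k+1]≡[n+1]C[k+1] (k + j) k)))
                     (solve 4 (λ p c₁ c₂ d → p :* (c₁ :+ c₂) :* d := p :* c₁ :* d :+ p :* c₂ :* d) refl
                        (a ^ j) ((k + j) C k) ((k + j) C suc k) (cRec 0 n (suc (k + j))))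
    shift : ∀ j → U (suc j) ≡ a * (a ^ j * ((suc k + j) C suc k) * cRec 0 n (suc (suc k + j)))
    shift j = trans (cong (λ z → a * a ^ j * (z C suc k) * cRec 0 n (suc z)) (+-suc k j))
                    (solve 4 (λ a p c d → a :* p :* c :* d := a :* (p :* c :* d)) refl
                       a (a ^ j) ((suc k + j) C suc k) (cRec 0 n (suc (suc k + j))))

cRec-expansion : ∀ a n k N → n ≤ N → cRec a n (suc k) ≡ expansion a n k N
cRec-expansion a zero          k N _ = sym (∑-zero N _ (λ j → *-zeroʳ (a ^ j * ((k + j) C k))))
cRec-expansion a (suc zero)    k N _ = sym (∑-zero N _ (λ j → *-zeroʳ (a ^ j * ((k + j) C k))))
cRec-expansion a (suc (suc n)) k (suc N) (s≤s n+1≤N) = begin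
    cRec a (suc n) (suc k) + a * cRec a n (suc k) + cRec a n k
  ≡⟨ +-assoc (cRec a (suc n) (suc k)) _ _ ⟩
    cRec a (suc n) (suc k) + (a * cRec a n (suc k) + cRec a n k)
  ≡⟨ cong₂ _+_ (cRec-expansion a (suc n) k (suc N) (m≤n⇒m≤1+n n+1≤N))
               (sym (expansion↓-suc a n N (cRec-expansion a n) (≤-trans (n≤1+n n) n+1≤N) k)) ⟩
    expansion a (suc n) k (suc N) + expansion↓ a n k (suc N)
  ≡⟨ sym (∑-+ (suc N) (λ j → w j * cRec 0 (suc n) (suc (k + j))) (λ j → w j * cRec 0 n (k + j))) ⟩
    ∑ (suc N) (λ j → w j * cRec 0 (suc n) (suc (k + j)) + w j * cRec 0 n (k + j))
  ≡⟨ ∑-cong (suc N) merge ⟩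
    expansion a (2 + n) k (suc N) ∎
  where open ≡-Reasoning
        w : ℕ → ℕ
        w j = a ^ j * ((k + j) C k)
        merge : ∀ j → w j * cRec 0 (suc n) (suc (k + j)) + w j * cRec 0 n (k + j)
                      ≡ w j * cRec 0 (2 + n) (suc (k + j))
        merge j = trans (sym (*-distribˡ-+ (w j) (cRec 0 (suc n) (suc (k + j))) (cRec 0 n (k + j))))
                        (cong (λ z → w j * (z + cRec 0 n (k + j)))
                              (sym (+-identityʳ (cRec 0 (suc n) (suc (k + j))))))

cRec-closedForm : ∀ a n k → suc k ≤ n / 2 → cRec a n (suc k) ≡ closedForm (suc a) n (suc k)
cRec-closedForm a n k k<n/2 = begin
    cRec a n (suc k)
  ≡⟨ cRec-expansion a n k (n + p) (m≤m+n n p) ⟩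
    expansion a n k (n + p)
  ≡⟨ ∑-truncate p (n + p) _ (m≤n+m p n) vanish ⟩
    ∑ p (λ j → a ^ j * ((k + j) C k) * cRec 0 n (suc (k + j)))
  ≡⟨ ∑-cong< p term ⟩
    ∑ p closedTerm
  ≡⟨ sym (sum0≡∑ (n / 2 ∸ suc k) closedTerm) ⟩
    closedForm (suc a) n (suc k) ∎
  where
    open ≡-Reasoning
    p = suc (n / 2 ∸ suc k)
    closedTerm : ℕ → ℕ
    closedTerm j = a ^ j * ((j + suc k ∸ 1) C k) * ((n ∸ suc k ∸ j ∸ 1) C (k + j))
    vanish : ∀ j → p ≤ j → a ^ j * ((k + j) C k) * cRec 0 n (suc (k + j)) ≡ 0
    vanish (suc j) (s≤s p≤j) =
      trans (cong (a ^ suc j * ((k + suc j) C k) *_) (cRec-<⇒0 0 n (suc (k + suc j)) (/2<⇒<+ n _ n/2<)))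
            (*-zeroʳ (a ^ suc j * ((k + suc j) C k)))
      where
        n/2< : n / 2 < suc (k + suc j)
        n/2< = ≤-<-trans (≤-trans (m≤n+m∸n (n / 2) (suc k)) (+-monoʳ-≤ (suc k) p≤j))
                         (+-monoʳ-< (suc k) (n<1+n j))
    term : ∀ j → j < p → a ^ j * ((k + j) C k) * cRec 0 n (suc (k + j)) ≡ closedTerm j
    term j (s≤s j≤n/2-k-1) = cong₂ (λ u v → a ^ j * u * v) (cong (_C k) k+j≡) binomial
      where
        k+j≡ : k + j ≡ j + suc k ∸ 1
        k+j≡ = sym (trans (cong (_∸ 1) (+-suc j k)) (+-comm j k))
        k+j<n/2 : suc (k + j) ≤ n / 2
        k+j<n/2 = ≤-trans (≤-reflexive (+-comm (suc k) j))
                    (≤-trans (+-monoˡ-≤ (suc k) j≤n/2-k-1) (≤-reflexive (m∸n+n≡m k<n/2)))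
        twice-n/2≤n : n / 2 + n / 2 ≤ n
        twice-n/2≤n = ≤-trans (≤-reflexive (trans (cong (n / 2 +_) (sym (+-identityʳ _))) (*-comm 2 (n / 2))))
                              (m/n*n≤m n 2)
        binomial : cRec 0 n (suc (k + j)) ≡ (n ∸ suc k ∸ j ∸ 1) C (k + j)
        binomial = trans (cRec0≡C (k + j) n (≤-trans (+-mono-≤ k+j<n/2 k+j<n/2) twice-n/2≤n))
                         (cong (λ z → (z ∸ 1) C (k + j)) (sym (∸-+-assoc n (suc k) j)))

corollary29 : (m : ℕ) → 1 ≤ m →
    ((n k : ℕ) → 3 < n → 1 ≤ k → k ≤ n / 2 → c m n k ≡ numWords m (n ∸ 3) (k ∸ 1))
    × ((n k : ℕ) → 1 ≤ k → k ≤ n / 2 → c m n k ≡ closedForm m n k)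
    × ((n k : ℕ) → n / 2 < k → k ≤ n → c m n k ≡ 0)
corollary29 (suc a) _ = words , closed , vanishing
  where
    c≡cRec : ∀ n k → c (suc a) n k ≡ cRec a n k
    c≡cRec = cWith-fibLike (f-fibLike a)

    words : ∀ n k → 3 < n → 1 ≤ k → k ≤ n / 2 → c (suc a) n k ≡ numWords (suc a) (n ∸ 3) (k ∸ 1)
    words (suc (suc (suc (suc L)))) (suc k) _ _ _ = trans (c≡cRec _ (suc k)) (cRec-numWords a (suc L) k)
    words (suc (suc zero))       _ (s≤s (s≤s ()))       _ _
    words (suc (suc (suc zero))) _ (s≤s (s≤s (s≤s ()))) _ _

    closed : ∀ n k → 1 ≤ k → k ≤ n / 2 → c (suc a) n k ≡ closedForm (suc a) n k
    closed n (suc k) _ k<n/2 = trans (c≡cRec n (suc k)) (cRec-closedForm a n k k<n/2)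

    vanishing : ∀ n k → n / 2 < k → k ≤ n → c (suc a) n k ≡ 0
    vanishing n k n/2<k _ = trans (c≡cRec n k) (cRec-<⇒0 a n k (/2<⇒<+ n k n/2<k))
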